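{- Let $\mathcal{C}$ and $\mathcal{D}$ be categories, $F\colon\mathcal{C}\to\mathcal{D}$ a functor, and let $\mathcal{M}$ be a class of morphisms of $\mathcal{C}$ that is part of an $(\mathcal{E},\mathcal{M})$-factorization system on $\mathcal{C}$. Then precise factorizations are unique up to isomorphism. Concretely: let $p_1\colon X\to FY_1$ and $p_2\colon X\to FY_2$ be $F$-precise (with respect to $\mathcal{M}$), and let $g\colon Y_1\to Z$ and $h\colon Y_2\to Z$ be morphisms in $\mathcal{M}$ with $Fg\cdot p_1=Fh\cdot p_2$. Then there is a morphism $d\colon Y_1\to Y_2$ with $Fd\cdot p_1=p_2$ and $h\cdot d=g$, and any such induced morphism $d$ is an isomorphism.
   Context: An $(\mathcal{E},\mathcal{M})$-factorization system on $\mathcal{C}$ consists of classes $\mathcal{E},\mathcal{M}$ of morphisms, both closed under composition and containing all isomorphisms, such that every morphism $f$ factors as $f=m\cdot e$ with $e\in\mathcal{E}$, $m\in\mathcal{M}$, and for every commutative square $g\cdot e=m\cdot f$ with $e\in\mathcal{E}$, $m\in\mathcal{M}$ there is a unique $d$ with $m\cdot d=g$ and $d\cdot e=f$ (the classes need not consist of epis/monos). For a functor $F\colon\mathcal{C}\to\mathcal{D}$ and a class $\mathcal{M}$ of morphisms of $\mathcal{C}$, a morphism $p\colon P\to FR$ in $\mathcal{D}$ is called $F$-precise (w.r.t. $\mathcal{M}$) if for all morphisms $f\colon P\to FC$ in $\mathcal{D}$ and all $m\colon R\to D$, $h\colon C\to D$ in $\mathcal{M}$ with $Fm\cdot p=Fh\cdot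 f$, there exists $d\colon R\to C$ (not necessarily unique) with $Fd\cdot p=f$ and $h\cdot d=m$. -}

module Defs where

open import Level using (Level; _⊔_; suc)
open import Relation.Binary.PropositionalEquality using (_≡_)
open import Data.Product using (Σ; ∃; ∃-syntax; _×_; _,_)

record Category (o ℓ : Level) : Set (suc (o ⊔ ℓ)) where
  infixr 9 _∘_
  field
    Obj : Set o
    Hom : Obj → Obj → Set ℓ
    id  : ∀ {A} → Hom A A
    _∘_ : ∀ {A B C} → Hom B C → Hom A B → Hom A C
    identityˡ : ∀ {A B} {f : Hom A B} → id ∘ f ≡ f
    identityʳ : ∀ {A B} {f : Hom A B} → f ∘ id ≡ f
    assoc : ∀ {A B C D} {f : Hom A B} {g : Hom B C} {h : Hom C D} →
            (h ∘ g) ∘ f ≡ h ∘ (g ∘ f)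

  IsIso : ∀ {A B} → Hom A B → Set ℓ
  IsIso {A} {B} f = Σ (Hom B A) λ g → (g ∘ f ≡ id) × (f ∘ g ≡ id)

record Functor {o ℓ o′ ℓ′} (C : Category o ℓ) (D : Category o′ ℓ′)
       : Set (o ⊔ ℓ ⊔ o′ ⊔ ℓ′) where
  private
    module C = Category C
    module D = Category D
  field
    F₀ : C.Obj → D.Obj
    F₁ : ∀ {A B} → C.Hom A B → D.Hom (F₀ A) (F₀ B)
    identity : ∀ {A} → F₁ (C.id {A}) ≡ D.id
    homomorphism : ∀ {A B E} {f : C.Hom A B} {g : C.Hom B E} →
                   F₁ (g C.∘ f) ≡ F₁ g D.∘ F₁ f

MorClass : ∀ {o ℓ} → Category o ℓ → (p : Level) → Set (o ⊔ ℓ ⊔ suc p)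
MorClass C p = ∀ {A B} → Category.Hom C A B → Set p

record IsFactorizationSystem {o ℓ p q} (C : Category o ℓ)
       (E : MorClass C p) (M : MorClass C q) : Set (o ⊔ ℓ ⊔ p ⊔ q) where
  open Category C
  field
    E-comp : ∀ {A B D} {f : Hom A B} {g : Hom B D} → E f → E g → E (g ∘ f)
    M-comp : ∀ {A B D} {f : Hom A B} {g : Hom B D} → M f → M g → M (g ∘ f)
    E-iso  : ∀ {A B} {f : Hom A B} → IsIso f → E f
    M-iso  : ∀ {A B} {f : Hom A B} → IsIso f → M f
    factor : ∀ {A B} (f : Hom A B) →
             Σ Obj λ I → Σ (Hom A I) λ e → Σ (Hom I B) λ m →
               E e × M m × (m ∘ e ≡ f)
    diagonal : ∀ {A B U V} {e : Hom A B} {m : Hom U V}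
               {f : Hom A U} {g : Hom B V} →
               E e → M m → g ∘ e ≡ m ∘ f →
               Σ (Hom B U) λ d → (m ∘ d ≡ g) × (d ∘ e ≡ f)
    diagonal-unique : ∀ {A B U V} {e : Hom A B} {m : Hom U V}
               {f : Hom A U} {g : Hom B V} →
               E e → M m → g ∘ e ≡ m ∘ f →
               ∀ (d d′ : Hom B U) →
               m ∘ d ≡ g → d ∘ e ≡ f → m ∘ d′ ≡ g → d′ ∘ e ≡ f → d ≡ d′

IsPrecise : ∀ {o ℓ o′ ℓ′ q} {C : Category o ℓ} {D : Category o′ ℓ′}
            (F : Functor C D) (M : MorClass C q)
            {P : Category.Obj D} {R : Category.Obj C} →
            Category.Hom D P (Functor.F₀ F R) → Set (o ⊔ ℓ ⊔ ℓ′ ⊔ q)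
IsPrecise {C = C} {D = D} F M {P} {R} p =
  ∀ {Cₒ Dₒ : Category.Obj C}
    (f : Category.Hom D P (F₀ Cₒ))
    (m : Category.Hom C R Dₒ) (h : Category.Hom C Cₒ Dₒ) →
    M m → M h →
    F₁ m D.∘ p ≡ F₁ h D.∘ f →
    Σ (Category.Hom C R Cₒ) λ d → (F₁ d D.∘ p ≡ f) × (h C.∘ d ≡ m)
  where
    open Functor F
    module C = Category C
    module D = Category D

-- Precision of p₂ yields a morphism e back, so e ∘ d and d ∘ e are endomorphisms
-- u commuting with a precise p and with an M-morphism g.  Such a u lies in M
-- because M is left-cancellable, so precision applied to p = F u ∘ p splits u by
-- a section s; s is again such an endomorphism, hence also has a section, and a
-- morphism with a section whose section has a section is invertible.
module Submission where

open import Defs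
open import Level using (_⊔_)
open import Relation.Binary.PropositionalEquality
  using (_≡_; refl; sym; trans; cong; subst; module ≡-Reasoning)
open import Data.Product using (Σ; _×_; _,_)

module IsoLemmas {o ℓ} (C : Category o ℓ) where
  open Category C
  open ≡-Reasoning

  id-isIso : ∀ {A} → IsIso (id {A})
  id-isIso = id , identityˡ , identityˡ

  retraction≡section : ∀ {A B} {d : Hom A B} {L R : Hom B A} →
                       L ∘ d ≡ id → d ∘ R ≡ id → L ≡ R
  retraction≡section {d = d} {L} {R} Ld dR = begin
    L             ≡⟨ sym identityʳ ⟩
    L ∘ id        ≡⟨ cong (L ∘_) (sym dR) ⟩
    L ∘ (d ∘ R)   ≡⟨ sym assoc ⟩
    (L ∘ d) ∘ R   ≡⟨ cong (_∘ R) Ld ⟩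
    id ∘ R        ≡⟨ identityˡ ⟩
    R             ∎

  isIso-if-retraction-and-section : ∀ {A B} {d : Hom A B} (L R : Hom B A) →
                                    L ∘ d ≡ id → d ∘ R ≡ id → IsIso d
  isIso-if-retraction-and-section {d = d} L R Ld dR =
    L , Ld , trans (cong (d ∘_) (retraction≡section Ld dR)) dR

  isIso-if-section-has-section : ∀ {A B} {u : Hom A B} {s : Hom B A} {t : Hom A B} →
                                 u ∘ s ≡ id → s ∘ t ≡ id → IsIso u
  isIso-if-section-has-section {s = s} us st =
    s , trans (cong (s ∘_) (retraction≡section us st)) st , us

  isIso-if-composites-isIso : ∀ {A B} {d : Hom A B} {e : Hom B A} →
                              IsIso (e ∘ d) → IsIso (d ∘ e) → IsIso d
  isIso-if-composites-isIso {e = e} (a , a∘ed≡id , _) (b , _ , de∘b≡id) =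
    isIso-if-retraction-and-section (a ∘ e) (e ∘ b)
      (trans assoc a∘ed≡id) (trans (sym assoc) de∘b≡id)

module FactorizationSystemLemmas {o ℓ p q} {C : Category o ℓ}
    {E : MorClass C p} {M : MorClass C q} (fs : IsFactorizationSystem C E M) where
  open Category C
  open IsFactorizationSystem fs
  open IsoLemmas C
  open ≡-Reasoning

  M-id : ∀ {A} → M (id {A})
  M-id = M-iso id-isIso

  -- Factor k = m ∘ e.  Lifting e against g ∘ k gives a retraction r of e, and
  -- e ∘ r, id are both diagonals of the trivial square of e against g ∘ m.
  M-cancelˡ : ∀ {A B Z} {g : Hom B Z} {k : Hom A B} → M g → M (g ∘ k) → M k
  M-cancelˡ {g = g} {k} Mg Mgk with factor k
  ... | _ , e , m , Ee , Mm , m∘e≡k with diagonal {f = id} {g = g ∘ m} Ee Mgk square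
    where
      square : (g ∘ m) ∘ e ≡ (g ∘ k) ∘ id
      square = begin
        (g ∘ m) ∘ e   ≡⟨ assoc ⟩
        g ∘ (m ∘ e)   ≡⟨ cong (g ∘_) m∘e≡k ⟩
        g ∘ k         ≡⟨ sym identityʳ ⟩
        (g ∘ k) ∘ id  ∎
  ... | r , gk∘r≡gm , r∘e≡id =
    subst M m∘e≡k (M-comp (M-iso (isIso-if-retraction-and-section r r r∘e≡id e∘r≡id)) Mm)
    where
      gm∘er≡gm : (g ∘ m) ∘ (e ∘ r) ≡ g ∘ m
      gm∘er≡gm = begin
        (g ∘ m) ∘ (e ∘ r)  ≡⟨ sym assoc ⟩
        ((g ∘ m) ∘ e) ∘ r  ≡⟨ cong (λ x → x ∘ r) (trans assoc (cong (g ∘_) m∘e≡k)) ⟩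
        (g ∘ k) ∘ r        ≡⟨ gk∘r≡gm ⟩
        g ∘ m              ∎

      e∘r≡id : e ∘ r ≡ id
      e∘r≡id = diagonal-unique Ee (M-comp Mm Mg) refl (e ∘ r) id
        gm∘er≡gm (trans assoc (trans (cong (e ∘_) r∘e≡id) identityʳ))
        identityʳ identityˡ

module Precision {o ℓ o′ ℓ′ p q} {C : Category o ℓ} {D : Category o′ ℓ′}
    (F : Functor C D) {E : MorClass C p} {M : MorClass C q}
    (fs : IsFactorizationSystem C E M) where
  open Category C
  module D = Category D
  open Functor F
  open IsoLemmas C
  open FactorizationSystemLemmas fs
  open ≡-Reasoning

  Mediates : ∀ {X Y Y′ Z} → D.Hom X (F₀ Y) → Hom Y Z → D.Hom X (F₀ Y′) → Hom Y′ Z →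
             Hom Y Y′ → Set (ℓ ⊔ ℓ′)
  Mediates p g p′ g′ d = (F₁ d D.∘ p ≡ p′) × (g′ ∘ d ≡ g)

  mediates-∘ : ∀ {X Y₁ Y₂ Y₃ Z} {p₁ : D.Hom X (F₀ Y₁)} {p₂ : D.Hom X (F₀ Y₂)}
               {p₃ : D.Hom X (F₀ Y₃)} {g₁ : Hom Y₁ Z} {g₂ : Hom Y₂ Z} {g₃ : Hom Y₃ Z}
               {d : Hom Y₁ Y₂} {e : Hom Y₂ Y₃} →
               Mediates p₁ g₁ p₂ g₂ d → Mediates p₂ g₂ p₃ g₃ e →
               Mediates p₁ g₁ p₃ g₃ (e ∘ d)
  mediates-∘ {p₁ = p₁} {p₂} {p₃} {g₁} {g₂} {g₃} {d} {e} (Fd , g₂d) (Fe , g₃e) =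
    Fed , g₃ed
    where
      Fed : F₁ (e ∘ d) D.∘ p₁ ≡ p₃
      Fed = begin
        F₁ (e ∘ d) D.∘ p₁          ≡⟨ cong (D._∘ p₁) homomorphism ⟩
        (F₁ e D.∘ F₁ d) D.∘ p₁     ≡⟨ D.assoc ⟩
        F₁ e D.∘ (F₁ d D.∘ p₁)     ≡⟨ cong (F₁ e D.∘_) Fd ⟩
        F₁ e D.∘ p₂                ≡⟨ Fe ⟩
        p₃                         ∎

      g₃ed : g₃ ∘ (e ∘ d) ≡ g₁
      g₃ed = begin
        g₃ ∘ (e ∘ d)   ≡⟨ sym assoc ⟩
        (g₃ ∘ e) ∘ d   ≡⟨ cong (_∘ d) g₃e ⟩
        g₂ ∘ d         ≡⟨ g₂d ⟩
        g₁             ∎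

  mediates⇒square : ∀ {X Y Y′ Z} {p : D.Hom X (F₀ Y)} {p′ : D.Hom X (F₀ Y′)}
                    {g : Hom Y Z} {g′ : Hom Y′ Z} {d : Hom Y Y′} →
                    Mediates p g p′ g′ d → F₁ g D.∘ p ≡ F₁ g′ D.∘ p′
  mediates⇒square {p = p} {p′} {g} {g′} {d} (Fd , g′d) = begin
    F₁ g D.∘ p                ≡⟨ cong (λ x → F₁ x D.∘ p) (sym g′d) ⟩
    F₁ (g′ ∘ d) D.∘ p         ≡⟨ cong (D._∘ p) homomorphism ⟩
    (F₁ g′ D.∘ F₁ d) D.∘ p    ≡⟨ D.assoc ⟩
    F₁ g′ D.∘ (F₁ d D.∘ p)    ≡⟨ cong (F₁ g′ D.∘_) Fd ⟩
    F₁ g′ D.∘ p′              ∎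

  precise-splits-M : ∀ {X Y Y′} {p : D.Hom X (F₀ Y)} {f : D.Hom X (F₀ Y′)} {u : Hom Y′ Y} →
                     IsPrecise F M p → M u → F₁ u D.∘ f ≡ p →
                     Σ (Hom Y Y′) λ s → (F₁ s D.∘ p ≡ f) × (u ∘ s ≡ id)
  precise-splits-M {p = p} {f} {u} prec Mu Fu∘f≡p =
    prec f id u M-id Mu (trans (cong (D._∘ p) identity) (trans D.identityˡ (sym Fu∘f≡p)))

  mediating-endo-section : ∀ {X Y Z} {p : D.Hom X (F₀ Y)} {g : Hom Y Z} {u : Hom Y Y} →
                           IsPrecise F M p → M g → Mediates p g p g u →
                           Σ (Hom Y Y) λ s → Mediates p g p g s × (u ∘ s ≡ id)
  mediating-endo-section {g = g} {u} prec Mg (Fu , gu) with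
    precise-splits-M prec (M-cancelˡ Mg (subst M (sym gu) Mg)) Fu
  ... | s , Fs , us = s , (Fs , gs) , us
    where
      gs : g ∘ s ≡ g
      gs = begin
        g ∘ s         ≡⟨ cong (_∘ s) (sym gu) ⟩
        (g ∘ u) ∘ s   ≡⟨ assoc ⟩
        g ∘ (u ∘ s)   ≡⟨ cong (g ∘_) us ⟩
        g ∘ id        ≡⟨ identityʳ ⟩
        g             ∎

  mediating-endo-isIso : ∀ {X Y Z} {p : D.Hom X (F₀ Y)} {g : Hom Y Z} {u : Hom Y Y} →
                         IsPrecise F M p → M g → Mediates p g p g u → IsIso u
  mediating-endo-isIso prec Mg med-u with mediating-endo-section prec Mg med-u
  ... | s , med-s , us with mediating-endo-section prec Mg med-s
  ... | t , _ , st = isIso-if-section-has-section us st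

  mediating-isIso : ∀ {X Y₁ Y₂ Z} {p₁ : D.Hom X (F₀ Y₁)} {p₂ : D.Hom X (F₀ Y₂)}
                    {g : Hom Y₁ Z} {h : Hom Y₂ Z} {d : Hom Y₁ Y₂} →
                    IsPrecise F M p₁ → IsPrecise F M p₂ → M g → M h →
                    Mediates p₁ g p₂ h d → IsIso d
  mediating-isIso {p₁ = p₁} {g = g} {h} prec₁ prec₂ Mg Mh med-d
    with prec₂ p₁ h g Mh Mg (sym (mediates⇒square med-d))
  ... | e , med-e = isIso-if-composites-isIso
    (mediating-endo-isIso prec₁ Mg (mediates-∘ med-d med-e))
    (mediating-endo-isIso prec₂ Mh (mediates-∘ med-e med-d))

lemma3p5 : ∀ {o ℓ o′ ℓ′ p q} (C : Category o ℓ) (D : Category o′ ℓ′)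
    (F : Functor C D) (E : MorClass C p) (M : MorClass C q) →
    IsFactorizationSystem C E M →
    ∀ {X : Category.Obj D} {Y₁ Y₂ Z : Category.Obj C}
      (p₁ : Category.Hom D X (Functor.F₀ F Y₁))
      (p₂ : Category.Hom D X (Functor.F₀ F Y₂))
      (g : Category.Hom C Y₁ Z) (h : Category.Hom C Y₂ Z) →
    IsPrecise F M p₁ → IsPrecise F M p₂ → M g → M h →
    Category._∘_ D (Functor.F₁ F g) p₁ ≡ Category._∘_ D (Functor.F₁ F h) p₂ →
    Σ (Category.Hom C Y₁ Y₂)
        (λ d → (Category._∘_ D (Functor.F₁ F d) p₁ ≡ p₂)
               × (Category._∘_ C h d ≡ g))
    × (∀ (d : Category.Hom C Y₁ Y₂) →
         Category._∘_ D (Functor.F₁ F d) p₁ ≡ p₂ →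
         Category._∘_ C h d ≡ g →
         Category.IsIso C d)
lemma3p5 C D F E M fs p₁ p₂ g h prec₁ prec₂ Mg Mh Fg∘p₁≡Fh∘p₂ =
  prec₁ p₂ g h Mg Mh Fg∘p₁≡Fh∘p₂ ,
  λ d Fd∘p₁≡p₂ h∘d≡g → mediating-isIso prec₁ prec₂ Mg Mh (Fd∘p₁≡p₂ , h∘d≡g)
  where open Precision F fs
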